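{- For all formulas $\phi,\chi$: $\phi\vDash_{\mathrm{NFL}_{\mathbf{M}\omega}}\chi$ if and only if there is a tableaux proof of $\phi\vdash_{\mathrm{NFL}_{\mathbf{M}\omega}}\chi$ (in the calculus for $\mathbf{M}\omega$ described in the context).
   Context: Semantics: $\mathbf{M}\omega$ is the lattice consisting of a top $\top$, a bottom $\bot$, and countably infinitely many pairwise incomparable middle elements $\mathbf{1},\mathbf{2},\ldots,\mathbf{n},\ldots$. Formulas are built from propositional variables using $\neg,\wedge,\vee$; a valuation maps variables to $\mathbf{M}\omega$ and is extended by interpreting $\wedge,\vee$ as meet and join and $\neg$ by $\neg\top=\bot$, $\neg\bot=\top$, $\neg x=x$ for each middle element $x$. $\phi\vDash_{\mathrm{NFL}_{\mathbf{M}\omega}}\chi$ iff for every valuation $v$, $v(\phi)\neq\bot$ implies $v(\chi)\neq\bot$. Tableaux: a tableau is a downward branching tree whose nodes contain labelled formulas $\mathfrak{t}[\phi]$, $\mathfrak{m}[\phi]$, $\mathfrak{f}[\phi]$ and labelled pairs $\phi\sim\chi$, $\phi\nsim\chi$; branches are regarded as sets. A branch containing the premise(s) of a rule may be extended by the rule; conclusions separated by $\mid$ split the branch. Rules ($i\in\{1,2\}$, $p,q,r$ propositional variables, $\circ\in\{\wedge,\vee\}$): $(\mathfrak{t}\wedge)$: $\mathfrak{t}[\phi\wedge\chi]$ / $\mathfrak{t}[\phi],\mathfrak{t}[\chi]$. $(\mathfrak{t}\vee)$: $\mathfrak{t}[\phi\vee\chi]$ / $\mathfrak{t}[\phi]\mid\mathfrak{t}[\chi]\mid\mathfrak{m}[\phi],\mathfrak{m}[\chi],\phi\nsim\chi$.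 $(\mathfrak{t}\neg)$: $\mathfrak{t}[\neg\phi]$ / $\mathfrak{f}[\phi]$. $(\mathfrak{m}\wedge)$: $\mathfrak{m}[\phi\wedge\chi]$ / $\mathfrak{t}[\phi],\mathfrak{m}[\chi]\mid\mathfrak{m}[\phi],\mathfrak{t}[\chi]\mid\mathfrak{m}[\phi],\mathfrak{m}[\chi],\phi\sim\chi$. $(\mathfrak{m}\vee)$: $\mathfrak{m}[\phi\vee\chi]$ / $\mathfrak{f}[\phi],\mathfrak{m}[\chi]\mid\mathfrak{m}[\phi],\mathfrak{f}[\chi]\mid\mathfrak{m}[\phi],\mathfrak{m}[\chi],\phi\sim\chi$. $(\mathfrak{m}\neg)$: $\mathfrak{m}[\neg\phi]$ / $\mathfrak{m}[\phi],\phi\sim\neg\phi$. $(\mathfrak{f}\wedge)$: $\mathfrak{f}[\phi\wedge\chi]$ / $\mathfrak{f}[\phi]\mid\mathfrak{f}[\chi]\mid\mathfrak{m}[\phi],\mathfrak{m}[\chi],\phi\nsim\chi$. $(\mathfrak{f}\vee)$: $\mathfrak{f}[\phi\vee\chi]$ / $\mathfrak{f}[\phi],\mathfrak{f}[\chi]$. $(\mathfrak{f}\neg)$: $\mathfrak{f}[\neg\phi]$ / $\mathfrak{t}[\phi]$. $(\sim\mathsf{sym})$: $\phi\sim\chi$ / $\chi\sim\phi$; $(\nsim\mathsf{sym})$: $\phi\nsim\chi$ / $\chi\nsim\phi$. $(\sim\mathsf{trans})$: $p\sim q,q\sim r$ / $p\sim r$; $(\nsim\mathsf{trans})$: $p\nsim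 q,q\sim r$ / $p\nsim r$. $(\neg\sim)$: $\neg\phi\sim\chi$ / $\phi\sim\chi$; $(\neg\nsim)$: $\neg\phi\nsim\chi$ / $\phi\nsim\chi$. $(\circ\sim)$: $\phi\sim\chi_1\circ\chi_2,\mathfrak{m}[\chi_i]$ / $\phi\sim\chi_i$; $(\circ\nsim)$: $\phi\nsim\chi_1\circ\chi_2,\mathfrak{m}[\chi_i]$ / $\phi\nsim\chi_i$. A branch is closed iff it contains one of: (1) $\mathcal{M}[\phi]$ and $\mathcal{M}'[\phi]$ for distinct labels $\mathcal{M},\mathcal{M}'\in\{\mathfrak{t},\mathfrak{m},\mathfrak{f}\}$; (2) $\phi\sim\chi$ and $\phi\nsim\chi$; (3) $\phi\nsim\phi$. A tableau is closed iff all its branches are closed. There is a tableaux proof of $\phi\vdash_{\mathrm{NFL}_{\mathbf{M}\omega}}\chi$ iff there are closed tableaux beginning with $\{\mathfrak{m}[\phi],\mathfrak{f}[\chi]\}$ and with $\{\mathfrak{t}[\phi],\mathfrak{f}[\chi]\}$. -}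

module Defs where

open import Data.Nat using (ℕ; _≟_)
open import Data.List using (List; []; _∷_; _++_)
open import Data.List.Membership.Propositional using (_∈_)
open import Data.Product using (_×_; Σ; ∃)
open import Data.Sum using (_⊎_)
open import Relation.Nullary using (¬_; yes; no)
open import Relation.Binary.PropositionalEquality using (_≡_; _≢_)

infixr 6 _∧′_
infixr 5 _∨′_

data Form : Set where
  var   : ℕ → Form
  ¬′_   : Form → Form
  _∧′_  : Form → Form → Form
  _∨′_  : Form → Form → Form

-- The lattice Mω: top, bot, and countably many pairwise incomparable
-- middle elements  mid 0, mid 1, ...  (standing for 1, 2, ...)

data Mω : Set where
  top : Mω
  bot : Mω
  mid : ℕ → Mω

_⊓_ : Mω → Mω → Mω
top   ⊓ y     = y
bot   ⊓ y     = bot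
mid n ⊓ top   = mid n
mid n ⊓ bot   = bot
mid n ⊓ mid k with n ≟ k
... | yes _ = mid n
... | no  _ = bot

_⊔_ : Mω → Mω → Mω
top   ⊔ y     = top
bot   ⊔ y     = y
mid n ⊔ top   = top
mid n ⊔ bot   = mid n
mid n ⊔ mid k with n ≟ k
... | yes _ = mid n
... | no  _ = top

neg : Mω → Mω
neg top     = bot
neg bot     = top
neg (mid n) = mid n

Valuation : Set
Valuation = ℕ → Mω

⟦_⟧ : Form → Valuation → Mω
⟦ var p ⟧   v = v p
⟦ ¬′ φ ⟧    v = neg (⟦ φ ⟧ v)
⟦ φ ∧′ χ ⟧  v = ⟦ φ ⟧ v ⊓ ⟦ χ ⟧ v
⟦ φ ∨′ χ ⟧  v = ⟦ φ ⟧ v ⊔ ⟦ χ ⟧ v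

_⊨_ : Form → Form → Set
φ ⊨ χ = ∀ (v : Valuation) → ⟦ φ ⟧ v ≢ bot → ⟦ χ ⟧ v ≢ bot

data Label : Set where
  𝔱 𝔪 𝔣 : Label

data Entry : Set where
  lab  : Label → Form → Entry
  _∼_  : Form → Form → Entry
  _≁_  : Form → Form → Entry

t[_] m[_] f[_] : Form → Entry
t[ φ ] = lab 𝔱 φ
m[ φ ] = lab 𝔪 φ
f[ φ ] = lab 𝔣 φ

Branch : Set
Branch = List Entry

-- Rules.  Rule ps cs : premises ps, and a list cs of alternative
-- conclusion sets (one per new branch; separated by ∣ in the paper).

data Rule : List Entry → List (List Entry) → Set where
  t∧ : ∀ φ χ → Rule (t[ φ ∧′ χ ] ∷ [])
                    ((t[ φ ] ∷ t[ χ ] ∷ []) ∷ [])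
  t∨ : ∀ φ χ → Rule (t[ φ ∨′ χ ] ∷ [])
                    ((t[ φ ] ∷ []) ∷ (t[ χ ] ∷ []) ∷ (m[ φ ] ∷ m[ χ ] ∷ (φ ≁ χ) ∷ []) ∷ [])
  t¬ : ∀ φ → Rule (t[ ¬′ φ ] ∷ []) ((f[ φ ] ∷ []) ∷ [])
  m∧ : ∀ φ χ → Rule (m[ φ ∧′ χ ] ∷ [])
                    ((t[ φ ] ∷ m[ χ ] ∷ []) ∷ (m[ φ ] ∷ t[ χ ] ∷ [])
                      ∷ (m[ φ ] ∷ m[ χ ] ∷ (φ ∼ χ) ∷ []) ∷ [])
  m∨ : ∀ φ χ → Rule (m[ φ ∨′ χ ] ∷ [])
                    ((f[ φ ] ∷ m[ χ ] ∷ []) ∷ (m[ φ ] ∷ f[ χ ] ∷ [])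
                      ∷ (m[ φ ] ∷ m[ χ ] ∷ (φ ∼ χ) ∷ []) ∷ [])
  m¬ : ∀ φ → Rule (m[ ¬′ φ ] ∷ []) ((m[ φ ] ∷ (φ ∼ (¬′ φ)) ∷ []) ∷ [])
  f∧ : ∀ φ χ → Rule (f[ φ ∧′ χ ] ∷ [])
                    ((f[ φ ] ∷ []) ∷ (f[ χ ] ∷ []) ∷ (m[ φ ] ∷ m[ χ ] ∷ (φ ≁ χ) ∷ []) ∷ [])
  f∨ : ∀ φ χ → Rule (f[ φ ∨′ χ ] ∷ [])
                    ((f[ φ ] ∷ f[ χ ] ∷ []) ∷ [])
  f¬ : ∀ φ → Rule (f[ ¬′ φ ] ∷ []) ((t[ φ ] ∷ []) ∷ [])
  ∼sym : ∀ φ χ → Rule ((φ ∼ χ) ∷ []) (((χ ∼ φ) ∷ []) ∷ [])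
  ≁sym : ∀ φ χ → Rule ((φ ≁ χ) ∷ []) (((χ ≁ φ) ∷ []) ∷ [])
  ∼trans : ∀ p q r → Rule ((var p ∼ var q) ∷ (var q ∼ var r) ∷ [])
                          (((var p ∼ var r) ∷ []) ∷ [])
  ≁trans : ∀ p q r → Rule ((var p ≁ var q) ∷ (var q ∼ var r) ∷ [])
                          (((var p ≁ var r) ∷ []) ∷ [])
  ¬∼ : ∀ φ χ → Rule (((¬′ φ) ∼ χ) ∷ []) (((φ ∼ χ) ∷ []) ∷ [])
  ¬≁ : ∀ φ χ → Rule (((¬′ φ) ≁ χ) ∷ []) (((φ ≁ χ) ∷ []) ∷ [])
  ∧∼₁ : ∀ φ χ₁ χ₂ → Rule ((φ ∼ (χ₁ ∧′ χ₂)) ∷ m[ χ₁ ] ∷ []) (((φ ∼ χ₁) ∷ []) ∷ [])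
  ∧∼₂ : ∀ φ χ₁ χ₂ → Rule ((φ ∼ (χ₁ ∧′ χ₂)) ∷ m[ χ₂ ] ∷ []) (((φ ∼ χ₂) ∷ []) ∷ [])
  ∨∼₁ : ∀ φ χ₁ χ₂ → Rule ((φ ∼ (χ₁ ∨′ χ₂)) ∷ m[ χ₁ ] ∷ []) (((φ ∼ χ₁) ∷ []) ∷ [])
  ∨∼₂ : ∀ φ χ₁ χ₂ → Rule ((φ ∼ (χ₁ ∨′ χ₂)) ∷ m[ χ₂ ] ∷ []) (((φ ∼ χ₂) ∷ []) ∷ [])
  ∧≁₁ : ∀ φ χ₁ χ₂ → Rule ((φ ≁ (χ₁ ∧′ χ₂)) ∷ m[ χ₁ ] ∷ []) (((φ ≁ χ₁) ∷ []) ∷ [])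
  ∧≁₂ : ∀ φ χ₁ χ₂ → Rule ((φ ≁ (χ₁ ∧′ χ₂)) ∷ m[ χ₂ ] ∷ []) (((φ ≁ χ₂) ∷ []) ∷ [])
  ∨≁₁ : ∀ φ χ₁ χ₂ → Rule ((φ ≁ (χ₁ ∨′ χ₂)) ∷ m[ χ₁ ] ∷ []) (((φ ≁ χ₁) ∷ []) ∷ [])
  ∨≁₂ : ∀ φ χ₁ χ₂ → Rule ((φ ≁ (χ₁ ∨′ χ₂)) ∷ m[ χ₂ ] ∷ []) (((φ ≁ χ₂) ∷ []) ∷ [])

data Closed (B : Branch) : Set where
  clash-label : ∀ {ℳ ℳ′ φ} → ℳ ≢ ℳ′ → lab ℳ φ ∈ B → lab ℳ′ φ ∈ B → Closed B
  clash-sim   : ∀ {φ χ} → (φ ∼ χ) ∈ B → (φ ≁ χ) ∈ B → Closed B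
  self-nsim   : ∀ {φ} → (φ ≁ φ) ∈ B → Closed B

data ClosedTableau (B : Branch) : Set where
  closed : Closed B → ClosedTableau B
  apply  : ∀ {ps cs} → Rule ps cs
         → (∀ {e} → e ∈ ps → e ∈ B)
         → (∀ {c} → c ∈ cs → ClosedTableau (c ++ B))
         → ClosedTableau B

_⊢_ : Form → Form → Set
φ ⊢ χ = ClosedTableau (m[ φ ] ∷ f[ χ ] ∷ []) × ClosedTableau (t[ φ ] ∷ f[ χ ] ∷ [])

{-# OPTIONS --safe #-}
-- Soundness: every rule is sound for Mω (a valuation forcing the premises forces some
-- conclusion set) and no valuation forces a closed branch.
--
-- Completeness: every entry a tableau for φ ⊢ χ can produce is built from subformulas
-- of φ and χ, a finite stock.  So the search that, while the branch is open, applies a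
-- rule adding a new entry to each resulting branch terminates, either in a closed
-- tableau or in an open saturated (Hintikka) branch.  Such a branch has a model:
-- variables labelled 𝔱 or 𝔣 go to ⊤ or ⊥, and an 𝔪-labelled variable goes to the middle
-- element named by the least variable ∼-related to it.  Labelled compound formulas are
-- then true because the labelled rules are invertible, and an entry a ∼ b or a ≁ b
-- between 𝔪-labelled formulas is pushed down to 𝔪-labelled variables by the (¬∼), (¬≁),
-- (∘∼) and (∘≁) rules, where ∼-transitivity and openness of the branch decide it.
module Submission where

open import Defs
open import Data.Empty using (⊥-elim)
open import Data.List using (List; []; _∷_; _++_; concat; cartesianProductWith)
open import Data.List.Membership.Propositional using (_∈_; _∉_; find; lose)
open import Data.List.Membership.Propositional.Properties
  using (∈-++⁺ˡ; ∈-++⁺ʳ; ∈-++⁻; ∈-concat⁺′; ∈-cartesianProductWith⁺)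
open import Data.List.Relation.Binary.Subset.Propositional using (_⊆_)
open import Data.List.Relation.Unary.All as All using (All; []; _∷_; lookup; all?)
open import Data.List.Relation.Unary.All.Properties using (anti-mono; ++⁺; ¬All⇒Any¬; ¬Any⇒All¬)
open import Data.List.Relation.Unary.Any using (Any; here; there; any?)
open import Data.Nat as ℕ using (ℕ; suc; _≤_; _<_; z≤n; s≤s)
open import Data.Nat.Induction using (<-rec; <-wellFounded)
open import Data.Nat.Properties using (anyUpTo?; ≤-antisym; ≮⇒≥; m≤n⇒m≤1+n)
open import Data.Product using (_×_; _,_; ∃; ∃₂; ∃-syntax; uncurry)
open import Data.Sum using (_⊎_; inj₁; inj₂; [_,_]′)
import Data.Sum as Sum
import Data.Sum.Effectful.Right as SumRight
open import Function using (_∘_; id; _⇔_; mk⇔; Equivalence)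
open import Induction.WellFounded using (WellFounded; Acc; acc)
open import Level using (0ℓ)
open import Relation.Binary using (DecidableEquality)
import Relation.Binary.Construct.On as On
open import Relation.Binary.PropositionalEquality
  using (_≡_; _≢_; refl; sym; trans; cong; cong₂; subst; module ≡-Reasoning)
open import Relation.Nullary using (¬_; Dec; yes; no; ¬?)
open import Relation.Nullary.Decidable using (map′; _×-dec_; _⊎-dec_; decidable-stable)
open import Relation.Unary using (Pred; Decidable)

open Equivalence using (to; from)

_≟ᶠ_ : DecidableEquality Form
var p    ≟ᶠ var q    = map′ (cong var) (λ { refl → refl }) (p ℕ.≟ q)
(¬′ a)   ≟ᶠ (¬′ b)   = map′ (cong ¬′_) (λ { refl → refl }) (a ≟ᶠ b)
(a ∧′ b) ≟ᶠ (c ∧′ d) =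
  map′ (uncurry (cong₂ _∧′_)) (λ { refl → refl , refl }) (a ≟ᶠ c ×-dec b ≟ᶠ d)
(a ∨′ b) ≟ᶠ (c ∨′ d) =
  map′ (uncurry (cong₂ _∨′_)) (λ { refl → refl , refl }) (a ≟ᶠ c ×-dec b ≟ᶠ d)
var _    ≟ᶠ (¬′ _)   = no λ ()
var _    ≟ᶠ (_ ∧′ _) = no λ ()
var _    ≟ᶠ (_ ∨′ _) = no λ ()
(¬′ _)   ≟ᶠ var _    = no λ ()
(¬′ _)   ≟ᶠ (_ ∧′ _) = no λ ()
(¬′ _)   ≟ᶠ (_ ∨′ _) = no λ ()
(_ ∧′ _) ≟ᶠ var _    = no λ ()
(_ ∧′ _) ≟ᶠ (¬′ _)   = no λ ()
(_ ∧′ _) ≟ᶠ (_ ∨′ _) = no λ ()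
(_ ∨′ _) ≟ᶠ var _    = no λ ()
(_ ∨′ _) ≟ᶠ (¬′ _)   = no λ ()
(_ ∨′ _) ≟ᶠ (_ ∧′ _) = no λ ()

_≟ᴸ_ : DecidableEquality Label
𝔱 ≟ᴸ 𝔱 = yes refl
𝔪 ≟ᴸ 𝔪 = yes refl
𝔣 ≟ᴸ 𝔣 = yes refl
𝔱 ≟ᴸ 𝔪 = no λ ()
𝔱 ≟ᴸ 𝔣 = no λ ()
𝔪 ≟ᴸ 𝔱 = no λ ()
𝔪 ≟ᴸ 𝔣 = no λ ()
𝔣 ≟ᴸ 𝔱 = no λ ()
𝔣 ≟ᴸ 𝔪 = no λ ()

_≟ᴱ_ : DecidableEquality Entry
lab ℳ a ≟ᴱ lab ℳ′ b =
  map′ (uncurry (cong₂ lab)) (λ { refl → refl , refl }) (ℳ ≟ᴸ ℳ′ ×-dec a ≟ᶠ b)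
(a ∼ b) ≟ᴱ (c ∼ d) =
  map′ (uncurry (cong₂ _∼_)) (λ { refl → refl , refl }) (a ≟ᶠ c ×-dec b ≟ᶠ d)
(a ≁ b) ≟ᴱ (c ≁ d) =
  map′ (uncurry (cong₂ _≁_)) (λ { refl → refl , refl }) (a ≟ᶠ c ×-dec b ≟ᶠ d)
lab _ _ ≟ᴱ (_ ∼ _)   = no λ ()
lab _ _ ≟ᴱ (_ ≁ _)   = no λ ()
(_ ∼ _) ≟ᴱ lab _ _   = no λ ()
(_ ∼ _) ≟ᴱ (_ ≁ _)   = no λ ()
(_ ≁ _) ≟ᴱ lab _ _   = no λ ()
(_ ≁ _) ≟ᴱ (_ ∼ _)   = no λ ()

open import Data.List.Membership.DecPropositional _≟ᴱ_ using (_∈?_)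

-- The lattice Mω

data IsMid : Mω → Set where
  is-mid : ∀ n → IsMid (mid n)

SameMid DistinctMid : Mω → Mω → Set
SameMid x y     = IsMid x × x ≡ y
DistinctMid x y = IsMid x × IsMid y × x ≢ y

Holds : Label → Mω → Set
Holds 𝔱 x = x ≡ top
Holds 𝔪 x = IsMid x
Holds 𝔣 x = x ≡ bot

Holds-unique : ∀ {ℳ ℳ′ x} → Holds ℳ x → Holds ℳ′ x → ℳ ≡ ℳ′
Holds-unique {𝔱} {𝔱} _ _ = refl
Holds-unique {𝔪} {𝔪} _ _ = refl
Holds-unique {𝔣} {𝔣} _ _ = refl
Holds-unique {𝔱} {𝔪} refl ()
Holds-unique {𝔱} {𝔣} refl ()
Holds-unique {𝔪} {𝔱} (is-mid _) ()
Holds-unique {𝔪} {𝔣} (is-mid _) ()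
Holds-unique {𝔣} {𝔱} refl ()
Holds-unique {𝔣} {𝔪} refl ()

top-or-mid : ∀ x → x ≢ bot → Holds 𝔱 x ⊎ Holds 𝔪 x
top-or-mid top     _   = inj₁ refl
top-or-mid bot     x≢⊥ = ⊥-elim (x≢⊥ refl)
top-or-mid (mid n) _   = inj₂ (is-mid n)

mid-injective : ∀ {m n} → mid m ≡ mid n → m ≡ n
mid-injective refl = refl

⊓-idem-mid : ∀ n → mid n ⊓ mid n ≡ mid n
⊓-idem-mid n with n ℕ.≟ n
... | yes _  = refl
... | no n≢n = ⊥-elim (n≢n refl)

⊔-idem-mid : ∀ n → mid n ⊔ mid n ≡ mid n
⊔-idem-mid n with n ℕ.≟ n
... | yes _  = refl
... | no n≢n = ⊥-elim (n≢n refl)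

⊓-distinct-mid : ∀ {m n} → mid m ≢ mid n → mid m ⊓ mid n ≡ bot
⊓-distinct-mid {m} {n} m≢n with m ℕ.≟ n
... | yes refl = ⊥-elim (m≢n refl)
... | no _     = refl

⊔-distinct-mid : ∀ {m n} → mid m ≢ mid n → mid m ⊔ mid n ≡ top
⊔-distinct-mid {m} {n} m≢n with m ℕ.≟ n
... | yes refl = ⊥-elim (m≢n refl)
... | no _     = refl

⊓-zeroʳ : ∀ x → x ⊓ bot ≡ bot
⊓-zeroʳ top     = refl
⊓-zeroʳ bot     = refl
⊓-zeroʳ (mid _) = refl

⊔-zeroʳ : ∀ x → x ⊔ top ≡ top
⊔-zeroʳ top     = refl
⊔-zeroʳ bot     = refl
⊔-zeroʳ (mid _) = refl

-- One equivalence per labelled rule: the premise holds iff some conclusion set does.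
-- Soundness uses the forward directions, the Hintikka model the backward ones.

⊓≡top : ∀ x y → x ⊓ y ≡ top ⇔ (x ≡ top × y ≡ top)
⊓≡top x y = mk⇔ (inv x y) λ { (refl , refl) → refl }
  where
  inv : ∀ x y → x ⊓ y ≡ top → x ≡ top × y ≡ top
  inv top top _ = refl , refl
  inv (mid m) (mid n) _ with m ℕ.≟ n
  inv (mid m) (mid n) () | yes _
  inv (mid m) (mid n) () | no _

⊔≡bot : ∀ x y → x ⊔ y ≡ bot ⇔ (x ≡ bot × y ≡ bot)
⊔≡bot x y = mk⇔ (inv x y) λ { (refl , refl) → refl }
  where
  inv : ∀ x y → x ⊔ y ≡ bot → x ≡ bot × y ≡ bot
  inv bot bot _ = refl , refl
  inv (mid m) (mid n) _ with m ℕ.≟ n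
  inv (mid m) (mid n) () | yes _
  inv (mid m) (mid n) () | no _

⊔≡top : ∀ x y → x ⊔ y ≡ top ⇔ (x ≡ top ⊎ y ≡ top ⊎ DistinctMid x y)
⊔≡top x y = mk⇔ (inv x y) (gen x y)
  where
  inv : ∀ x y → x ⊔ y ≡ top → x ≡ top ⊎ y ≡ top ⊎ DistinctMid x y
  inv top     _       _ = inj₁ refl
  inv bot     top     _ = inj₂ (inj₁ refl)
  inv (mid _) top     _ = inj₂ (inj₁ refl)
  inv (mid m) (mid n) _ with m ℕ.≟ n
  inv (mid m) (mid n) () | yes _
  ... | no m≢n = inj₂ (inj₂ (is-mid m , is-mid n , m≢n ∘ mid-injective))
  gen : ∀ x y → x ≡ top ⊎ y ≡ top ⊎ DistinctMid x y → x ⊔ y ≡ top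
  gen _ _ (inj₁ refl)                               = refl
  gen x _ (inj₂ (inj₁ refl))                        = ⊔-zeroʳ x
  gen _ _ (inj₂ (inj₂ (is-mid _ , is-mid _ , m≢n))) = ⊔-distinct-mid m≢n

⊓≡bot : ∀ x y → x ⊓ y ≡ bot ⇔ (x ≡ bot ⊎ y ≡ bot ⊎ DistinctMid x y)
⊓≡bot x y = mk⇔ (inv x y) (gen x y)
  where
  inv : ∀ x y → x ⊓ y ≡ bot → x ≡ bot ⊎ y ≡ bot ⊎ DistinctMid x y
  inv bot     _       _ = inj₁ refl
  inv top     bot     _ = inj₂ (inj₁ refl)
  inv (mid _) bot     _ = inj₂ (inj₁ refl)
  inv (mid m) (mid n) _ with m ℕ.≟ n
  inv (mid m) (mid n) () | yes _
  ... | no m≢n = inj₂ (inj₂ (is-mid m , is-mid n , m≢n ∘ mid-injective))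
  gen : ∀ x y → x ≡ bot ⊎ y ≡ bot ⊎ DistinctMid x y → x ⊓ y ≡ bot
  gen _ _ (inj₁ refl)                               = refl
  gen x _ (inj₂ (inj₁ refl))                        = ⊓-zeroʳ x
  gen _ _ (inj₂ (inj₂ (is-mid _ , is-mid _ , m≢n))) = ⊓-distinct-mid m≢n

⊓-mid : ∀ x y → IsMid (x ⊓ y)
                ⇔ (x ≡ top × IsMid y ⊎ IsMid x × y ≡ top ⊎ IsMid x × IsMid y × SameMid x y)
⊓-mid x y = mk⇔ (inv x y) (gen x y)
  where
  inv : ∀ x y → IsMid (x ⊓ y)
              → x ≡ top × IsMid y ⊎ IsMid x × y ≡ top ⊎ IsMid x × IsMid y × SameMid x y
  inv top     y       my = inj₁ (refl , my)
  inv (mid m) top     _  = inj₂ (inj₁ (is-mid m , refl))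
  inv (mid m) (mid n) _  with m ℕ.≟ n
  ... | yes refl = inj₂ (inj₂ (is-mid m , is-mid m , is-mid m , refl))
  inv (mid m) (mid n) () | no _
  gen : ∀ x y → x ≡ top × IsMid y ⊎ IsMid x × y ≡ top ⊎ IsMid x × IsMid y × SameMid x y
              → IsMid (x ⊓ y)
  gen _ _ (inj₁ (refl , my))                      = my
  gen _ _ (inj₂ (inj₁ (is-mid m , refl)))         = is-mid m
  gen _ _ (inj₂ (inj₂ (is-mid m , _ , _ , refl)))  = subst IsMid (sym (⊓-idem-mid m)) (is-mid m)

⊔-mid : ∀ x y → IsMid (x ⊔ y)
                ⇔ (x ≡ bot × IsMid y ⊎ IsMid x × y ≡ bot ⊎ IsMid x × IsMid y × SameMid x y)
⊔-mid x y = mk⇔ (inv x y) (gen x y)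
  where
  inv : ∀ x y → IsMid (x ⊔ y)
              → x ≡ bot × IsMid y ⊎ IsMid x × y ≡ bot ⊎ IsMid x × IsMid y × SameMid x y
  inv bot     y       my = inj₁ (refl , my)
  inv (mid m) bot     _  = inj₂ (inj₁ (is-mid m , refl))
  inv (mid m) (mid n) _  with m ℕ.≟ n
  ... | yes refl = inj₂ (inj₂ (is-mid m , is-mid m , is-mid m , refl))
  inv (mid m) (mid n) () | no _
  gen : ∀ x y → x ≡ bot × IsMid y ⊎ IsMid x × y ≡ bot ⊎ IsMid x × IsMid y × SameMid x y
              → IsMid (x ⊔ y)
  gen _ _ (inj₁ (refl , my))                      = my
  gen _ _ (inj₂ (inj₁ (is-mid m , refl)))         = is-mid m
  gen _ _ (inj₂ (inj₂ (is-mid m , _ , _ , refl)))  = subst IsMid (sym (⊔-idem-mid m)) (is-mid m)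

neg≡top : ∀ x → neg x ≡ top ⇔ x ≡ bot
neg≡top x = mk⇔ (inv x) λ { refl → refl }
  where
  inv : ∀ x → neg x ≡ top → x ≡ bot
  inv bot _ = refl

neg≡bot : ∀ x → neg x ≡ bot ⇔ x ≡ top
neg≡bot x = mk⇔ (inv x) λ { refl → refl }
  where
  inv : ∀ x → neg x ≡ bot → x ≡ top
  inv top _ = refl

neg-fixed : ∀ {x} → IsMid x → neg x ≡ x
neg-fixed (is-mid _) = refl

neg-mid : ∀ x → IsMid (neg x) ⇔ (IsMid x × SameMid x (neg x))
neg-mid x = mk⇔ (inv x) λ { (is-mid n , _) → is-mid n }
  where
  inv : ∀ x → IsMid (neg x) → IsMid x × SameMid x (neg x)
  inv (mid n) _ = is-mid n , is-mid n , refl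

⊓-absorbˡ : ∀ x y → IsMid (x ⊓ y) → IsMid x → x ⊓ y ≡ x
⊓-absorbˡ (mid m) top     _ _ = refl
⊓-absorbˡ (mid m) (mid n) _ _ with m ℕ.≟ n
... | yes _ = refl
⊓-absorbˡ (mid m) (mid n) () _ | no _

⊓-absorbʳ : ∀ x y → IsMid (x ⊓ y) → IsMid y → x ⊓ y ≡ y
⊓-absorbʳ top     (mid n) _ _ = refl
⊓-absorbʳ (mid m) (mid n) _ _ with m ℕ.≟ n
... | yes refl = refl
⊓-absorbʳ (mid m) (mid n) () _ | no _

⊔-absorbˡ : ∀ x y → IsMid (x ⊔ y) → IsMid x → x ⊔ y ≡ x
⊔-absorbˡ (mid m) bot     _ _ = refl
⊔-absorbˡ (mid m) (mid n) _ _ with m ℕ.≟ n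
... | yes _ = refl
⊔-absorbˡ (mid m) (mid n) () _ | no _

⊔-absorbʳ : ∀ x y → IsMid (x ⊔ y) → IsMid y → x ⊔ y ≡ y
⊔-absorbʳ bot     (mid n) _ _ = refl
⊔-absorbʳ (mid m) (mid n) _ _ with m ℕ.≟ n
... | yes refl = refl
⊔-absorbʳ (mid m) (mid n) () _ | no _

-- Soundness

_⊩_ : Valuation → Entry → Set
v ⊩ lab ℳ a = Holds ℳ (⟦ a ⟧ v)
v ⊩ (a ∼ b) = SameMid (⟦ a ⟧ v) (⟦ b ⟧ v)
v ⊩ (a ≁ b) = DistinctMid (⟦ a ⟧ v) (⟦ b ⟧ v)

-- Saturated (v ⊩_) says that the rules are sound for v, Saturated (_∈ B) that B is saturated.
Saturated : (Entry → Set) → Set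
Saturated P = ∀ {ps cs} → Rule ps cs → All P ps → Any (All P) cs

rules-sound : ∀ v → Saturated (v ⊩_)
rules-sound v (t∧ a b) (p ∷ []) with to (⊓≡top (⟦ a ⟧ v) (⟦ b ⟧ v)) p
... | pa , pb = here (pa ∷ pb ∷ [])
rules-sound v (t∨ a b) (p ∷ []) with to (⊔≡top (⟦ a ⟧ v) (⟦ b ⟧ v)) p
... | inj₁ pa                       = here (pa ∷ [])
... | inj₂ (inj₁ pb)                = there (here (pb ∷ []))
... | inj₂ (inj₂ a≁b@(ma , mb , _)) = there (there (here (ma ∷ mb ∷ a≁b ∷ [])))
rules-sound v (t¬ a) (p ∷ []) = here (to (neg≡top (⟦ a ⟧ v)) p ∷ [])
rules-sound v (m∧ a b) (p ∷ []) with to (⊓-mid (⟦ a ⟧ v) (⟦ b ⟧ v)) p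
... | inj₁ (pa , pb)            = here (pa ∷ pb ∷ [])
... | inj₂ (inj₁ (pa , pb))     = there (here (pa ∷ pb ∷ []))
... | inj₂ (inj₂ (pa , pb , s)) = there (there (here (pa ∷ pb ∷ s ∷ [])))
rules-sound v (m∨ a b) (p ∷ []) with to (⊔-mid (⟦ a ⟧ v) (⟦ b ⟧ v)) p
... | inj₁ (pa , pb)            = here (pa ∷ pb ∷ [])
... | inj₂ (inj₁ (pa , pb))     = there (here (pa ∷ pb ∷ []))
... | inj₂ (inj₂ (pa , pb , s)) = there (there (here (pa ∷ pb ∷ s ∷ [])))
rules-sound v (m¬ a) (p ∷ []) with to (neg-mid (⟦ a ⟧ v)) p
... | pa , s = here (pa ∷ s ∷ [])
rules-sound v (f∧ a b) (p ∷ []) with to (⊓≡bot (⟦ a ⟧ v) (⟦ b ⟧ v)) p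
... | inj₁ pa                       = here (pa ∷ [])
... | inj₂ (inj₁ pb)                = there (here (pb ∷ []))
... | inj₂ (inj₂ a≁b@(ma , mb , _)) = there (there (here (ma ∷ mb ∷ a≁b ∷ [])))
rules-sound v (f∨ a b) (p ∷ []) with to (⊔≡bot (⟦ a ⟧ v) (⟦ b ⟧ v)) p
... | pa , pb = here (pa ∷ pb ∷ [])
rules-sound v (f¬ a) (p ∷ []) = here (to (neg≡bot (⟦ a ⟧ v)) p ∷ [])
rules-sound v (∼sym a b) ((ma , a≡b) ∷ []) = here ((subst IsMid a≡b ma , sym a≡b) ∷ [])
rules-sound v (≁sym a b) ((ma , mb , a≢b) ∷ []) = here ((mb , ma , a≢b ∘ sym) ∷ [])
rules-sound v (∼trans p q r) ((mp , p≡q) ∷ (_ , q≡r) ∷ []) = here ((mp , trans p≡q q≡r) ∷ [])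
rules-sound v (≁trans p q r) ((mp , mq , p≢q) ∷ (_ , q≡r) ∷ []) =
  here ((mp , subst IsMid q≡r mq , λ p≡r → p≢q (trans p≡r (sym q≡r))) ∷ [])
rules-sound v (¬∼ a b) ((m¬a , ¬a≡b) ∷ []) with to (neg-mid (⟦ a ⟧ v)) m¬a
... | ma , _ , a≡¬a = here ((ma , trans a≡¬a ¬a≡b) ∷ [])
rules-sound v (¬≁ a b) ((m¬a , mb , ¬a≢b) ∷ []) with to (neg-mid (⟦ a ⟧ v)) m¬a
... | ma , _ , a≡¬a = here ((ma , mb , λ a≡b → ¬a≢b (trans (sym a≡¬a) a≡b)) ∷ [])
rules-sound v (∧∼₁ a b c) ((ma , a≡bc) ∷ mb ∷ []) =
  here ((ma , trans a≡bc (⊓-absorbˡ (⟦ b ⟧ v) (⟦ c ⟧ v) (subst IsMid a≡bc ma) mb)) ∷ [])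
rules-sound v (∧∼₂ a b c) ((ma , a≡bc) ∷ mc ∷ []) =
  here ((ma , trans a≡bc (⊓-absorbʳ (⟦ b ⟧ v) (⟦ c ⟧ v) (subst IsMid a≡bc ma) mc)) ∷ [])
rules-sound v (∨∼₁ a b c) ((ma , a≡bc) ∷ mb ∷ []) =
  here ((ma , trans a≡bc (⊔-absorbˡ (⟦ b ⟧ v) (⟦ c ⟧ v) (subst IsMid a≡bc ma) mb)) ∷ [])
rules-sound v (∨∼₂ a b c) ((ma , a≡bc) ∷ mc ∷ []) =
  here ((ma , trans a≡bc (⊔-absorbʳ (⟦ b ⟧ v) (⟦ c ⟧ v) (subst IsMid a≡bc ma) mc)) ∷ [])
rules-sound v (∧≁₁ a b c) ((ma , mbc , a≢bc) ∷ mb ∷ []) =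
  here ((ma , mb , λ a≡b → a≢bc (trans a≡b (sym (⊓-absorbˡ (⟦ b ⟧ v) (⟦ c ⟧ v) mbc mb))))
        ∷ [])
rules-sound v (∧≁₂ a b c) ((ma , mbc , a≢bc) ∷ mc ∷ []) =
  here ((ma , mc , λ a≡c → a≢bc (trans a≡c (sym (⊓-absorbʳ (⟦ b ⟧ v) (⟦ c ⟧ v) mbc mc))))
        ∷ [])
rules-sound v (∨≁₁ a b c) ((ma , mbc , a≢bc) ∷ mb ∷ []) =
  here ((ma , mb , λ a≡b → a≢bc (trans a≡b (sym (⊔-absorbˡ (⟦ b ⟧ v) (⟦ c ⟧ v) mbc mb))))
        ∷ [])
rules-sound v (∨≁₂ a b c) ((ma , mbc , a≢bc) ∷ mc ∷ []) =
  here ((ma , mc , λ a≡c → a≢bc (trans a≡c (sym (⊔-absorbʳ (⟦ b ⟧ v) (⟦ c ⟧ v) mbc mc))))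
        ∷ [])

closed-unsatisfiable : ∀ v {B} → Closed B → ¬ All (v ⊩_) B
closed-unsatisfiable v (clash-label ℳ≢ℳ′ x y) ⊩B =
  ℳ≢ℳ′ (Holds-unique (lookup ⊩B x) (lookup ⊩B y))
closed-unsatisfiable v (clash-sim x y) ⊩B with lookup ⊩B x | lookup ⊩B y
... | _ , a≡b | _ , _ , a≢b = a≢b a≡b
closed-unsatisfiable v (self-nsim x) ⊩B with lookup ⊩B x
... | _ , _ , a≢a = a≢a refl

closed-tableau-unsatisfiable : ∀ v {B} → ClosedTableau B → ¬ All (v ⊩_) B
closed-tableau-unsatisfiable v (closed c) = closed-unsatisfiable v c
closed-tableau-unsatisfiable v (apply r ps⊆B children) ⊩B
  with find (rules-sound v r (anti-mono ps⊆B ⊩B))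
... | c , c∈cs , ⊩c = closed-tableau-unsatisfiable v (children c∈cs) (++⁺ ⊩c ⊩B)

soundness : ∀ φ χ → φ ⊢ χ → φ ⊨ χ
soundness φ χ (m-tableau , t-tableau) v φ≢bot χ≡bot with top-or-mid (⟦ φ ⟧ v) φ≢bot
... | inj₁ φ≡top = closed-tableau-unsatisfiable v t-tableau (φ≡top ∷ χ≡bot ∷ [])
... | inj₂ φ-mid = closed-tableau-unsatisfiable v m-tableau (φ-mid ∷ χ≡bot ∷ [])

-- Hintikka branches have models

-- The rules for ∼ and ≁ come in parallel families; indexing them by PairKind lets the
-- Hintikka argument and the rule enumeration treat both at once.
data PairKind : Set where
  sim nsim : PairKind

pair : PairKind → Form → Form → Entry
pair sim  = _∼_
pair nsim = _≁_

sym-rule : ∀ k a b → Rule (pair k a b ∷ []) ((pair k b a ∷ []) ∷ [])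
sym-rule sim  = ∼sym
sym-rule nsim = ≁sym

¬-rule : ∀ k a b → Rule (pair k (¬′ a) b ∷ []) ((pair k a b ∷ []) ∷ [])
¬-rule sim  = ¬∼
¬-rule nsim = ¬≁

∧ˡ-rule : ∀ k a b c → Rule (pair k a (b ∧′ c) ∷ m[ b ] ∷ []) ((pair k a b ∷ []) ∷ [])
∧ˡ-rule sim  = ∧∼₁
∧ˡ-rule nsim = ∧≁₁

∧ʳ-rule : ∀ k a b c → Rule (pair k a (b ∧′ c) ∷ m[ c ] ∷ []) ((pair k a c ∷ []) ∷ [])
∧ʳ-rule sim  = ∧∼₂
∧ʳ-rule nsim = ∧≁₂

∨ˡ-rule : ∀ k a b c → Rule (pair k a (b ∨′ c) ∷ m[ b ] ∷ []) ((pair k a b ∷ []) ∷ [])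
∨ˡ-rule sim  = ∨∼₁
∨ˡ-rule nsim = ∨≁₁

∨ʳ-rule : ∀ k a b c → Rule (pair k a (b ∨′ c) ∷ m[ c ] ∷ []) ((pair k a c ∷ []) ∷ [])
∨ʳ-rule sim  = ∨∼₂
∨ʳ-rule nsim = ∨≁₂

trans-rule : ∀ k p q r → Rule (pair k (var p) (var q) ∷ (var q ∼ var r) ∷ [])
                               ((pair k (var p) (var r) ∷ []) ∷ [])
trans-rule sim  = ∼trans
trans-rule nsim = ≁trans

record Least (P : Pred ℕ 0ℓ) : Set where
  field
    value   : ℕ
    holds   : P value
    minimal : ∀ {m} → m < value → ¬ P m

least : ∀ {P : Pred ℕ 0ℓ} → Decidable P → ∀ {n} → P n → Least P
least {P} P? {n} = <-rec (λ n → P n → Least P) step n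
  where
  step : ∀ n → (∀ {m} → m < n → P m → Least P) → P n → Least P
  step n smaller Pn with anyUpTo? P? n
  ... | yes (m , m<n , Pm) = smaller m<n Pm
  ... | no none            =
    record { value = n ; holds = Pn ; minimal = λ m<n Pm → none (_ , m<n , Pm) }

least-unique : ∀ {P Q : Pred ℕ 0ℓ} → (∀ {n} → P n → Q n) → (∀ {n} → Q n → P n)
             → (x : Least P) (y : Least Q) → Least.value x ≡ Least.value y
least-unique P⇒Q Q⇒P x y = ≤-antisym
  (≮⇒≥ λ y<x → Least.minimal x y<x (Q⇒P (Least.holds y)))
  (≮⇒≥ λ x<y → Least.minimal y x<y (P⇒Q (Least.holds x)))

record Hintikka (B : Branch) : Set where
  field
    saturated : Saturated (_∈ B)
    ¬closed   : ¬ Closed B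

module HintikkaModel {B : Branch} (H : Hintikka B) where
  open Hintikka H

  forced₁ : ∀ {e e′} → Rule (e ∷ []) ((e′ ∷ []) ∷ []) → e ∈ B → e′ ∈ B
  forced₁ r e∈B with saturated r (e∈B ∷ [])
  ... | here (e′∈B ∷ []) = e′∈B

  forced₂ : ∀ {e₁ e₂ e′} → Rule (e₁ ∷ e₂ ∷ []) ((e′ ∷ []) ∷ [])
          → e₁ ∈ B → e₂ ∈ B → e′ ∈ B
  forced₂ r e₁∈B e₂∈B with saturated r (e₁∈B ∷ e₂∈B ∷ [])
  ... | here (e′∈B ∷ []) = e′∈B

  pair-¬ʳ : ∀ k {a b} → pair k a (¬′ b) ∈ B → pair k a b ∈ B
  pair-¬ʳ k {a} {b} =
    forced₁ (sym-rule k b a) ∘ forced₁ (¬-rule k b a) ∘ forced₁ (sym-rule k a (¬′ b))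

  _≈_ : ℕ → ℕ → Set
  p ≈ q = p ≡ q ⊎ (var p ∼ var q) ∈ B

  _≈?_ : ∀ p q → Dec (p ≈ q)
  p ≈? q = (p ℕ.≟ q) ⊎-dec ((var p ∼ var q) ∈? B)

  ≈-sym : ∀ {p q} → p ≈ q → q ≈ p
  ≈-sym (inj₁ refl) = inj₁ refl
  ≈-sym (inj₂ p∼q)  = inj₂ (forced₁ (∼sym _ _) p∼q)

  ≈-trans : ∀ {p q r} → p ≈ q → q ≈ r → p ≈ r
  ≈-trans (inj₁ refl) q≈r         = q≈r
  ≈-trans p≈q         (inj₁ refl) = p≈q
  ≈-trans (inj₂ p∼q)  (inj₂ q∼r)  = inj₂ (forced₂ (∼trans _ _ _) p∼q q∼r)

  class : ∀ p → Least (p ≈_)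
  class p = least (p ≈?_) (inj₁ refl)

  rep : ℕ → ℕ
  rep p = Least.value (class p)

  rep-cong : ∀ {p q} → p ≈ q → rep p ≡ rep q
  rep-cong {p} {q} p≈q = least-unique (≈-trans (≈-sym p≈q)) (≈-trans p≈q) (class p) (class q)

  rep-injective : ∀ {p q} → rep p ≡ rep q → p ≈ q
  rep-injective {p} {q} eq =
    ≈-trans (Least.holds (class p)) (subst (_≈ q) (sym eq) (≈-sym (Least.holds (class q))))

  v : Valuation
  v p with t[ var p ] ∈? B | f[ var p ] ∈? B
  ... | yes _ | _     = top
  ... | no _  | yes _ = bot
  ... | no _  | no _  = mid (rep p)

  v-mid : ∀ {p} → m[ var p ] ∈ B → v p ≡ mid (rep p)
  v-mid {p} m with t[ var p ] ∈? B | f[ var p ] ∈? B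
  ... | yes t | _     = ⊥-elim (¬closed (clash-label (λ ()) t m))
  ... | no _  | yes f = ⊥-elim (¬closed (clash-label (λ ()) f m))
  ... | no _  | no _  = refl

  v-holds : ∀ ℳ {p} → lab ℳ (var p) ∈ B → Holds ℳ (v p)
  v-holds 𝔪 m = subst IsMid (sym (v-mid m)) (is-mid _)
  v-holds 𝔱 {p} t with t[ var p ] ∈? B | f[ var p ] ∈? B
  ... | yes _ | _     = refl
  ... | no ¬t | _     = ⊥-elim (¬t t)
  v-holds 𝔣 {p} f with t[ var p ] ∈? B | f[ var p ] ∈? B
  ... | yes t | _     = ⊥-elim (¬closed (clash-label (λ ()) t f))
  ... | no _  | yes _ = refl
  ... | no _  | no ¬f = ⊥-elim (¬f f)

  vars-∼ : ∀ {q r} → (var q ∼ var r) ∈ B → m[ var q ] ∈ B → m[ var r ] ∈ B → v q ≡ v r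
  vars-∼ {q} {r} q∼r mq mr = begin
    v q           ≡⟨ v-mid mq ⟩
    mid (rep q)   ≡⟨ cong mid (rep-cong (inj₂ q∼r)) ⟩
    mid (rep r)   ≡⟨ v-mid mr ⟨
    v r           ∎
    where open ≡-Reasoning

  vars-≁ : ∀ {q r} → (var q ≁ var r) ∈ B → m[ var q ] ∈ B → m[ var r ] ∈ B → v q ≢ v r
  vars-≁ {q} {r} q≁r mq mr vq≡vr
    with rep-injective {q} {r} (mid-injective (trans (sym (v-mid mq)) (trans vq≡vr (v-mid mr))))
  ... | inj₁ refl = ¬closed (self-nsim q≁r)
  ... | inj₂ q∼r  = ¬closed (clash-sim q∼r q≁r)

  m-conjunct : ∀ {a b} → m[ a ∧′ b ] ∈ B → m[ a ] ∈ B ⊎ m[ b ] ∈ B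
  m-conjunct {a} {b} m with saturated (m∧ a b) (m ∷ [])
  ... | here (_ ∷ mb ∷ [])                   = inj₂ mb
  ... | there (here (ma ∷ _ ∷ []))           = inj₁ ma
  ... | there (there (here (ma ∷ _ ∷ _ ∷ []))) = inj₁ ma

  m-disjunct : ∀ {a b} → m[ a ∨′ b ] ∈ B → m[ a ] ∈ B ⊎ m[ b ] ∈ B
  m-disjunct {a} {b} m with saturated (m∨ a b) (m ∷ [])
  ... | here (_ ∷ mb ∷ [])                   = inj₂ mb
  ... | there (here (ma ∷ _ ∷ []))           = inj₁ ma
  ... | there (there (here (ma ∷ _ ∷ _ ∷ []))) = inj₁ ma

  record Descent (k : PairKind) (a b : Form) : Set where
    constructor descent
    field
      target   : ℕ
      paired   : pair k a (var target) ∈ B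
      labelled : m[ var target ] ∈ B
      value    : ⟦ b ⟧ v ≡ v target

  via : ∀ {k a b c} → ⟦ b ⟧ v ≡ ⟦ c ⟧ v → Descent k a c → Descent k a b
  via b≡c (descent q s mq c≡q) = descent q s mq (trans b≡c c≡q)

  true-t  : ∀ a → t[ a ] ∈ B → ⟦ a ⟧ v ≡ top
  true-m  : ∀ a → m[ a ] ∈ B → IsMid (⟦ a ⟧ v)
  true-f  : ∀ a → f[ a ] ∈ B → ⟦ a ⟧ v ≡ bot
  true-∼  : ∀ {a b} → (a ∼ b) ∈ B → m[ a ] ∈ B → m[ b ] ∈ B → ⟦ a ⟧ v ≡ ⟦ b ⟧ v
  true-≁  : ∀ {a b} → (a ≁ b) ∈ B → m[ a ] ∈ B → m[ b ] ∈ B → ⟦ a ⟧ v ≢ ⟦ b ⟧ v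
  -- The IsMid argument follows from m[ b ] ∈ B; passing it in keeps the recursion structural.
  descend : ∀ k {a} b → pair k a b ∈ B → m[ b ] ∈ B → IsMid (⟦ b ⟧ v) → Descent k a b

  true-t (var p) t = v-holds 𝔱 t
  true-t (¬′ a) t with saturated (t¬ a) (t ∷ [])
  ... | here (fa ∷ []) = from (neg≡top (⟦ a ⟧ v)) (true-f a fa)
  true-t (a ∧′ b) t with saturated (t∧ a b) (t ∷ [])
  ... | here (ta ∷ tb ∷ []) = from (⊓≡top (⟦ a ⟧ v) (⟦ b ⟧ v)) (true-t a ta , true-t b tb)
  true-t (a ∨′ b) t with saturated (t∨ a b) (t ∷ [])
  ... | here (ta ∷ []) =
    from (⊔≡top (⟦ a ⟧ v) (⟦ b ⟧ v)) (inj₁ (true-t a ta))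
  ... | there (here (tb ∷ [])) =
    from (⊔≡top (⟦ a ⟧ v) (⟦ b ⟧ v)) (inj₂ (inj₁ (true-t b tb)))
  ... | there (there (here (ma ∷ mb ∷ a≁b ∷ []))) =
    from (⊔≡top (⟦ a ⟧ v) (⟦ b ⟧ v))
      (inj₂ (inj₂ (true-m a ma , true-m b mb , true-≁ a≁b ma mb)))

  true-f (var p) f = v-holds 𝔣 f
  true-f (¬′ a) f with saturated (f¬ a) (f ∷ [])
  ... | here (ta ∷ []) = from (neg≡bot (⟦ a ⟧ v)) (true-t a ta)
  true-f (a ∧′ b) f with saturated (f∧ a b) (f ∷ [])
  ... | here (fa ∷ []) =
    from (⊓≡bot (⟦ a ⟧ v) (⟦ b ⟧ v)) (inj₁ (true-f a fa))
  ... | there (here (fb ∷ [])) =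
    from (⊓≡bot (⟦ a ⟧ v) (⟦ b ⟧ v)) (inj₂ (inj₁ (true-f b fb)))
  ... | there (there (here (ma ∷ mb ∷ a≁b ∷ []))) =
    from (⊓≡bot (⟦ a ⟧ v) (⟦ b ⟧ v))
      (inj₂ (inj₂ (true-m a ma , true-m b mb , true-≁ a≁b ma mb)))
  true-f (a ∨′ b) f with saturated (f∨ a b) (f ∷ [])
  ... | here (fa ∷ fb ∷ []) = from (⊔≡bot (⟦ a ⟧ v) (⟦ b ⟧ v)) (true-f a fa , true-f b fb)

  true-m (var p) m = v-holds 𝔪 m
  true-m (¬′ a) m with saturated (m¬ a) (m ∷ [])
  ... | here (ma ∷ _ ∷ []) = subst IsMid (sym (neg-fixed (true-m a ma))) (true-m a ma)
  true-m (a ∧′ b) m with saturated (m∧ a b) (m ∷ [])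
  ... | here (ta ∷ mb ∷ []) =
    from (⊓-mid (⟦ a ⟧ v) (⟦ b ⟧ v)) (inj₁ (true-t a ta , true-m b mb))
  ... | there (here (ma ∷ tb ∷ [])) =
    from (⊓-mid (⟦ a ⟧ v) (⟦ b ⟧ v)) (inj₂ (inj₁ (true-m a ma , true-t b tb)))
  ... | there (there (here (ma ∷ mb ∷ a∼b ∷ []))) =
    from (⊓-mid (⟦ a ⟧ v) (⟦ b ⟧ v))
      (inj₂ (inj₂ (true-m a ma , true-m b mb , true-m a ma , true-∼ a∼b ma mb)))
  true-m (a ∨′ b) m with saturated (m∨ a b) (m ∷ [])
  ... | here (fa ∷ mb ∷ []) =
    from (⊔-mid (⟦ a ⟧ v) (⟦ b ⟧ v)) (inj₁ (true-f a fa , true-m b mb))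
  ... | there (here (ma ∷ fb ∷ [])) =
    from (⊔-mid (⟦ a ⟧ v) (⟦ b ⟧ v)) (inj₂ (inj₁ (true-m a ma , true-f b fb)))
  ... | there (there (here (ma ∷ mb ∷ a∼b ∷ []))) =
    from (⊔-mid (⟦ a ⟧ v) (⟦ b ⟧ v))
      (inj₂ (inj₂ (true-m a ma , true-m b mb , true-m a ma , true-∼ a∼b ma mb)))

  true-∼ {a} {b} a∼b ma mb with descend sim b a∼b mb (true-m b mb)
  ... | descent q a∼q mq b≡q with descend sim a (forced₁ (∼sym _ _) a∼q) ma (true-m a ma)
  ... | descent r q∼r mr a≡r = begin
    ⟦ a ⟧ v   ≡⟨ a≡r ⟩
    v r       ≡⟨ vars-∼ q∼r mq mr ⟨
    v q       ≡⟨ b≡q ⟨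
    ⟦ b ⟧ v   ∎
    where open ≡-Reasoning

  true-≁ {a} {b} a≁b ma mb a≡b with descend nsim b a≁b mb (true-m b mb)
  ... | descent q a≁q mq b≡q with descend nsim a (forced₁ (≁sym _ _) a≁q) ma (true-m a ma)
  ... | descent r q≁r mr a≡r = vars-≁ q≁r mq mr (trans (sym b≡q) (trans (sym a≡b) a≡r))

  descend k (var q) s mq _ = descent q s mq refl
  descend k (¬′ b) s m¬b _ with saturated (m¬ b) (m¬b ∷ [])
  ... | here (mb ∷ _ ∷ []) =
    via (neg-fixed (true-m b mb)) (descend k b (pair-¬ʳ k s) mb (true-m b mb))
  descend k (b ∧′ c) s mbc mid-bc with m-conjunct mbc
  ... | inj₁ mb = via (⊓-absorbˡ (⟦ b ⟧ v) (⟦ c ⟧ v) mid-bc (true-m b mb))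
                      (descend k b (forced₂ (∧ˡ-rule k _ b c) s mb) mb (true-m b mb))
  ... | inj₂ mc = via (⊓-absorbʳ (⟦ b ⟧ v) (⟦ c ⟧ v) mid-bc (true-m c mc))
                      (descend k c (forced₂ (∧ʳ-rule k _ b c) s mc) mc (true-m c mc))
  descend k (b ∨′ c) s mbc mid-bc with m-disjunct mbc
  ... | inj₁ mb = via (⊔-absorbˡ (⟦ b ⟧ v) (⟦ c ⟧ v) mid-bc (true-m b mb))
                      (descend k b (forced₂ (∨ˡ-rule k _ b c) s mb) mb (true-m b mb))
  ... | inj₂ mc = via (⊔-absorbʳ (⟦ b ⟧ v) (⟦ c ⟧ v) mid-bc (true-m c mc))
                      (descend k c (forced₂ (∨ʳ-rule k _ b c) s mc) mc (true-m c mc))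

  forces : ∀ {ℳ a} → lab ℳ a ∈ B → v ⊩ lab ℳ a
  forces {𝔱} = true-t _
  forces {𝔪} = true-m _
  forces {𝔣} = true-f _

-- Proof search

Instance : Set
Instance = ∃₂ Rule

⟨_⟩ : ∀ {ps cs} → Rule ps cs → Instance
⟨ r ⟩ = _ , _ , r

labelled-instances : Label → Form → List Instance
labelled-instances _ (var _)  = []
labelled-instances 𝔱 (¬′ a)   = ⟨ t¬ a ⟩ ∷ []
labelled-instances 𝔱 (a ∧′ b) = ⟨ t∧ a b ⟩ ∷ []
labelled-instances 𝔱 (a ∨′ b) = ⟨ t∨ a b ⟩ ∷ []
labelled-instances 𝔪 (¬′ a)   = ⟨ m¬ a ⟩ ∷ []
labelled-instances 𝔪 (a ∧′ b) = ⟨ m∧ a b ⟩ ∷ []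
labelled-instances 𝔪 (a ∨′ b) = ⟨ m∨ a b ⟩ ∷ []
labelled-instances 𝔣 (¬′ a)   = ⟨ f¬ a ⟩ ∷ []
labelled-instances 𝔣 (a ∧′ b) = ⟨ f∧ a b ⟩ ∷ []
labelled-instances 𝔣 (a ∨′ b) = ⟨ f∨ a b ⟩ ∷ []

negation-instances : PairKind → Form → Form → List Instance
negation-instances k (¬′ a) b = ⟨ ¬-rule k a b ⟩ ∷ []
negation-instances _ _      _ = []

descent-instances : PairKind → Form → Form → List Instance
descent-instances k a (b ∧′ c) = ⟨ ∧ˡ-rule k a b c ⟩ ∷ ⟨ ∧ʳ-rule k a b c ⟩ ∷ []
descent-instances k a (b ∨′ c) = ⟨ ∨ˡ-rule k a b c ⟩ ∷ ⟨ ∨ʳ-rule k a b c ⟩ ∷ []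
descent-instances _ _ _        = []

transitivity-instances : PairKind → Form → Form → Entry → List Instance
transitivity-instances k (var p) (var q) (_ ∼ var r) = ⟨ trans-rule k p q r ⟩ ∷ []
transitivity-instances _ _       _       _           = []

-- The rule instances with first premise e; a second premise is determined by e,
-- except for transitivity, where e′ supplies its last variable.
instances : Entry → Entry → List Instance
instances (lab ℳ a) _  = labelled-instances ℳ a
instances (a ∼ b)   e′ = ⟨ ∼sym a b ⟩ ∷ descent-instances sim a b
                         ++ negation-instances sim a b ++ transitivity-instances sim a b e′
instances (a ≁ b)   e′ = ⟨ ≁sym a b ⟩ ∷ descent-instances nsim a b
                         ++ negation-instances nsim a b ++ transitivity-instances nsim a b e′

candidates : Branch → List Instance
candidates B = concat (cartesianProductWith instances B B)

candidate : ∀ {B e e′ i} → e ∈ B → e′ ∈ B → i ∈ instances e e′ → i ∈ candidates B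
candidate e∈B e′∈B i∈ = ∈-concat⁺′ i∈ (∈-cartesianProductWith⁺ instances e∈B e′∈B)

candidates-complete : ∀ {B ps cs} (r : Rule ps cs) → All (_∈ B) ps → ⟨ r ⟩ ∈ candidates B
candidates-complete (t∧ _ _)       (x ∷ [])     = candidate x x (here refl)
candidates-complete (t∨ _ _)       (x ∷ [])     = candidate x x (here refl)
candidates-complete (t¬ _)         (x ∷ [])     = candidate x x (here refl)
candidates-complete (m∧ _ _)       (x ∷ [])     = candidate x x (here refl)
candidates-complete (m∨ _ _)       (x ∷ [])     = candidate x x (here refl)
candidates-complete (m¬ _)         (x ∷ [])     = candidate x x (here refl)
candidates-complete (f∧ _ _)       (x ∷ [])     = candidate x x (here refl)
candidates-complete (f∨ _ _)       (x ∷ [])     = candidate x x (here refl)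
candidates-complete (f¬ _)         (x ∷ [])     = candidate x x (here refl)
candidates-complete (∼sym _ _)     (x ∷ [])     = candidate x x (here refl)
candidates-complete (≁sym _ _)     (x ∷ [])     = candidate x x (here refl)
candidates-complete (∼trans _ _ _) (x ∷ y ∷ []) = candidate x y (there (here refl))
candidates-complete (≁trans _ _ _) (x ∷ y ∷ []) = candidate x y (there (here refl))
candidates-complete (∧∼₁ _ _ _)    (x ∷ _ ∷ []) = candidate x x (there (here refl))
candidates-complete (∧∼₂ _ _ _)    (x ∷ _ ∷ []) = candidate x x (there (there (here refl)))
candidates-complete (∨∼₁ _ _ _)    (x ∷ _ ∷ []) = candidate x x (there (here refl))
candidates-complete (∨∼₂ _ _ _)    (x ∷ _ ∷ []) = candidate x x (there (there (here refl)))
candidates-complete (∧≁₁ _ _ _)    (x ∷ _ ∷ []) = candidate x x (there (here refl))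
candidates-complete (∧≁₂ _ _ _)    (x ∷ _ ∷ []) = candidate x x (there (there (here refl)))
candidates-complete (∨≁₁ _ _ _)    (x ∷ _ ∷ []) = candidate x x (there (here refl))
candidates-complete (∨≁₂ _ _ _)    (x ∷ _ ∷ []) = candidate x x (there (there (here refl)))
candidates-complete (¬∼ _ b)       (x ∷ [])     =
  candidate x x (there (∈-++⁺ʳ (descent-instances sim _ b) (here refl)))
candidates-complete (¬≁ _ b)       (x ∷ [])     =
  candidate x x (there (∈-++⁺ʳ (descent-instances nsim _ b) (here refl)))

Expands : Branch → Instance → Set
Expands B (ps , cs , _) = All (_∈ B) ps × ¬ Any (All (_∈ B)) cs

expands? : ∀ B → Decidable (Expands B)
expands? B (ps , cs , _) = all? (_∈? B) ps ×-dec ¬? (any? (all? (_∈? B)) cs)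

saturated-or-expandable : ∀ B → Saturated (_∈ B) ⊎ ∃ (Expands B)
saturated-or-expandable B with any? (expands? B) (candidates B)
... | yes expandable = inj₂ (let i , _ , expands = find expandable in i , expands)
... | no ¬expandable = inj₁ λ r ps∈B → decidable-stable (any? (all? (_∈? B)) _) λ new →
  ¬expandable (lose (candidates-complete r ps∈B) (ps∈B , new))

data Clash : Entry → Entry → Set where
  label-clash : ∀ {ℳ ℳ′ a} → ℳ ≢ ℳ′ → Clash (lab ℳ a) (lab ℳ′ a)
  pair-clash  : ∀ {a b} → Clash (a ∼ b) (a ≁ b)
  self-clash  : ∀ {a e} → Clash (a ≁ a) e    -- a ≁ a closes on its own; e is arbitrary

clash? : ∀ e e′ → Dec (Clash e e′)
clash? (lab ℳ a) (lab ℳ′ a′) with ℳ ≟ᴸ ℳ′ | a ≟ᶠ a′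
... | no ℳ≢ℳ′ | yes refl = yes (label-clash ℳ≢ℳ′)
... | yes refl | _       = no λ { (label-clash ℳ≢ℳ) → ℳ≢ℳ refl }
... | no _     | no a≢a′ = no λ { (label-clash _) → a≢a′ refl }
clash? (lab _ _) (_ ∼ _) = no λ ()
clash? (lab _ _) (_ ≁ _) = no λ ()
clash? (a ∼ b) (a′ ≁ b′) with a ≟ᶠ a′ | b ≟ᶠ b′
... | yes refl | yes refl = yes pair-clash
... | no a≢a′  | _        = no λ { pair-clash → a≢a′ refl }
... | yes _    | no b≢b′  = no λ { pair-clash → b≢b′ refl }
clash? (_ ∼ _) (lab _ _) = no λ ()
clash? (_ ∼ _) (_ ∼ _)   = no λ ()
clash? (a ≁ b) _ with a ≟ᶠ b
... | yes refl = yes self-clash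
... | no a≢b   = no λ { self-clash → a≢b refl }

closed? : ∀ B → Dec (Closed B)
closed? B = map′ from-clash to-clash (any? (λ e → any? (clash? e) B) B)
  where
  from-clash : Any (λ e → Any (Clash e) B) B → Closed B
  from-clash clashing with find clashing
  ... | e , e∈B , clashes-with-e with find clashes-with-e
  ... | _ , e′∈B , label-clash ℳ≢ℳ′ = clash-label ℳ≢ℳ′ e∈B e′∈B
  ... | _ , e′∈B , pair-clash       = clash-sim e∈B e′∈B
  ... | _ , _    , self-clash        = self-nsim e∈B
  to-clash : Closed B → Any (λ e → Any (Clash e) B) B
  to-clash (clash-label ℳ≢ℳ′ x y) = lose x (lose y (label-clash ℳ≢ℳ′))
  to-clash (clash-sim x y)        = lose x (lose y pair-clash)
  to-clash (self-nsim x)          = lose x (lose x self-clash)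

subformulas proper-subformulas : Form → List Form
subformulas a = a ∷ proper-subformulas a
proper-subformulas (var _)  = []
proper-subformulas (¬′ a)   = subformulas a
proper-subformulas (a ∧′ b) = subformulas a ++ subformulas b
proper-subformulas (a ∨′ b) = subformulas a ++ subformulas b

SubformulaClosed : List Form → Set
SubformulaClosed S = ∀ {a} → a ∈ S → subformulas a ⊆ S

subformulas-closed : ∀ a → SubformulaClosed (subformulas a)
subformulas-closed a        (here refl) = id
subformulas-closed (¬′ a)   (there b∈a) = there ∘ subformulas-closed a b∈a
subformulas-closed (a ∧′ b) (there c∈ab) with ∈-++⁻ (subformulas a) c∈ab
... | inj₁ c∈a = there ∘ ∈-++⁺ˡ ∘ subformulas-closed a c∈a
... | inj₂ c∈b = there ∘ ∈-++⁺ʳ (subformulas a) ∘ subformulas-closed b c∈b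
subformulas-closed (a ∨′ b) (there c∈ab) with ∈-++⁻ (subformulas a) c∈ab
... | inj₁ c∈a = there ∘ ∈-++⁺ˡ ∘ subformulas-closed a c∈a
... | inj₂ c∈b = there ∘ ∈-++⁺ʳ (subformulas a) ∘ subformulas-closed b c∈b

++-subformula-closed : ∀ {S T} → SubformulaClosed S → SubformulaClosed T → SubformulaClosed (S ++ T)
++-subformula-closed {S} S-closed T-closed a∈ with ∈-++⁻ S a∈
... | inj₁ a∈S = ∈-++⁺ˡ ∘ S-closed a∈S
... | inj₂ a∈T = ∈-++⁺ʳ S ∘ T-closed a∈T

labels : List Label
labels = 𝔱 ∷ 𝔪 ∷ 𝔣 ∷ []

∈-labels : ∀ ℳ → ℳ ∈ labels
∈-labels 𝔱 = here refl
∈-labels 𝔪 = there (here refl)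
∈-labels 𝔣 = there (there (here refl))

missing : List Entry → Branch → ℕ
missing []      B = 0
missing (u ∷ U) B with u ∈? B
... | yes _ = missing U B
... | no  _ = suc (missing U B)

missing-anti : ∀ U {B B′} → B ⊆ B′ → missing U B′ ≤ missing U B
missing-anti []      _ = z≤n
missing-anti (u ∷ U) {B} {B′} B⊆B′ with u ∈? B | u ∈? B′
... | yes _   | yes _   = missing-anti U B⊆B′
... | yes u∈B | no u∉B′ = ⊥-elim (u∉B′ (B⊆B′ u∈B))
... | no _    | yes _   = m≤n⇒m≤1+n (missing-anti U B⊆B′)
... | no _    | no _    = s≤s (missing-anti U B⊆B′)

missing-strict : ∀ U {B B′ x} → B ⊆ B′ → x ∈ U → x ∈ B′ → x ∉ B
               → missing U B′ < missing U B
missing-strict (u ∷ U) {B} {B′} B⊆B′ (here refl) x∈B′ x∉B with u ∈? B | u ∈? B′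
... | yes x∈B | _       = ⊥-elim (x∉B x∈B)
... | no _    | yes _   = s≤s (missing-anti U B⊆B′)
... | no _    | no x∉B′ = ⊥-elim (x∉B′ x∈B′)
missing-strict (u ∷ U) {B} {B′} B⊆B′ (there x∈U) x∈B′ x∉B with u ∈? B | u ∈? B′
... | yes _   | yes _   = missing-strict U B⊆B′ x∈U x∈B′ x∉B
... | yes u∈B | no u∉B′ = ⊥-elim (u∉B′ (B⊆B′ u∈B))
... | no _    | yes _   = m≤n⇒m≤1+n (missing-strict U B⊆B′ x∈U x∈B′ x∉B)
... | no _    | no _    = s≤s (missing-strict U B⊆B′ x∈U x∈B′ x∉B)

HintikkaExtension : Branch → Set
HintikkaExtension B = ∃[ B′ ] B ⊆ B′ × Hintikka B′

module Search (S : List Form) (S-closed : SubformulaClosed S) where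

  ∈-¬ : ∀ {a} → ¬′ a ∈ S → a ∈ S
  ∈-¬ a∈ = S-closed a∈ (there (here refl))

  ∈-∧ˡ : ∀ {a b} → a ∧′ b ∈ S → a ∈ S
  ∈-∧ˡ {b = b} ab∈ = S-closed ab∈ (there (∈-++⁺ˡ {ys = subformulas b} (here refl)))

  ∈-∧ʳ : ∀ {a b} → a ∧′ b ∈ S → b ∈ S
  ∈-∧ʳ {a} ab∈ = S-closed ab∈ (there (∈-++⁺ʳ (subformulas a) (here refl)))

  ∈-∨ˡ : ∀ {a b} → a ∨′ b ∈ S → a ∈ S
  ∈-∨ˡ {b = b} ab∈ = S-closed ab∈ (there (∈-++⁺ˡ {ys = subformulas b} (here refl)))

  ∈-∨ʳ : ∀ {a b} → a ∨′ b ∈ S → b ∈ S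
  ∈-∨ʳ {a} ab∈ = S-closed ab∈ (there (∈-++⁺ʳ (subformulas a) (here refl)))

  Over : Entry → Set
  Over (lab _ a) = a ∈ S
  Over (a ∼ b)   = a ∈ S × b ∈ S
  Over (a ≁ b)   = a ∈ S × b ∈ S

  rules-preserve-over : ∀ {ps cs} → Rule ps cs → All Over ps → All (All Over) cs
  rules-preserve-over (t∧ _ _) (ab ∷ []) = (∈-∧ˡ ab ∷ ∈-∧ʳ ab ∷ []) ∷ []
  rules-preserve-over (t∨ _ _) (ab ∷ []) =
    (∈-∨ˡ ab ∷ []) ∷
    (∈-∨ʳ ab ∷ []) ∷
    (∈-∨ˡ ab ∷ ∈-∨ʳ ab ∷ (∈-∨ˡ ab , ∈-∨ʳ ab) ∷ []) ∷ []
  rules-preserve-over (t¬ _) (a ∷ []) = (∈-¬ a ∷ []) ∷ []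
  rules-preserve-over (m∧ _ _) (ab ∷ []) =
    (∈-∧ˡ ab ∷ ∈-∧ʳ ab ∷ []) ∷
    (∈-∧ˡ ab ∷ ∈-∧ʳ ab ∷ []) ∷
    (∈-∧ˡ ab ∷ ∈-∧ʳ ab ∷ (∈-∧ˡ ab , ∈-∧ʳ ab) ∷ []) ∷ []
  rules-preserve-over (m∨ _ _) (ab ∷ []) =
    (∈-∨ˡ ab ∷ ∈-∨ʳ ab ∷ []) ∷
    (∈-∨ˡ ab ∷ ∈-∨ʳ ab ∷ []) ∷
    (∈-∨ˡ ab ∷ ∈-∨ʳ ab ∷ (∈-∨ˡ ab , ∈-∨ʳ ab) ∷ []) ∷ []
  rules-preserve-over (m¬ _) (a ∷ []) = (∈-¬ a ∷ (∈-¬ a , a) ∷ []) ∷ []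
  rules-preserve-over (f∧ _ _) (ab ∷ []) =
    (∈-∧ˡ ab ∷ []) ∷
    (∈-∧ʳ ab ∷ []) ∷
    (∈-∧ˡ ab ∷ ∈-∧ʳ ab ∷ (∈-∧ˡ ab , ∈-∧ʳ ab) ∷ []) ∷ []
  rules-preserve-over (f∨ _ _) (ab ∷ []) = (∈-∨ˡ ab ∷ ∈-∨ʳ ab ∷ []) ∷ []
  rules-preserve-over (f¬ _) (a ∷ []) = (∈-¬ a ∷ []) ∷ []
  rules-preserve-over (∼sym _ _)     ((a , b) ∷ [])           = ((b , a) ∷ []) ∷ []
  rules-preserve-over (≁sym _ _)     ((a , b) ∷ [])           = ((b , a) ∷ []) ∷ []
  rules-preserve-over (∼trans _ _ _) ((p , _) ∷ (_ , r) ∷ []) = ((p , r) ∷ []) ∷ []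
  rules-preserve-over (≁trans _ _ _) ((p , _) ∷ (_ , r) ∷ []) = ((p , r) ∷ []) ∷ []
  rules-preserve-over (¬∼ _ _)       ((a , b) ∷ [])           = ((∈-¬ a , b) ∷ []) ∷ []
  rules-preserve-over (¬≁ _ _)       ((a , b) ∷ [])           = ((∈-¬ a , b) ∷ []) ∷ []
  rules-preserve-over (∧∼₁ _ _ _)    ((a , bc) ∷ _ ∷ [])      = ((a , ∈-∧ˡ bc) ∷ []) ∷ []
  rules-preserve-over (∧∼₂ _ _ _)    ((a , bc) ∷ _ ∷ [])      = ((a , ∈-∧ʳ bc) ∷ []) ∷ []
  rules-preserve-over (∨∼₁ _ _ _)    ((a , bc) ∷ _ ∷ [])      = ((a , ∈-∨ˡ bc) ∷ []) ∷ []
  rules-preserve-over (∨∼₂ _ _ _)    ((a , bc) ∷ _ ∷ [])      = ((a , ∈-∨ʳ bc) ∷ []) ∷ []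
  rules-preserve-over (∧≁₁ _ _ _)    ((a , bc) ∷ _ ∷ [])      = ((a , ∈-∧ˡ bc) ∷ []) ∷ []
  rules-preserve-over (∧≁₂ _ _ _)    ((a , bc) ∷ _ ∷ [])      = ((a , ∈-∧ʳ bc) ∷ []) ∷ []
  rules-preserve-over (∨≁₁ _ _ _)    ((a , bc) ∷ _ ∷ [])      = ((a , ∈-∨ˡ bc) ∷ []) ∷ []
  rules-preserve-over (∨≁₂ _ _ _)    ((a , bc) ∷ _ ∷ [])      = ((a , ∈-∨ʳ bc) ∷ []) ∷ []

  labelled-universe sim-universe nsim-universe universe : List Entry
  labelled-universe = cartesianProductWith lab labels S
  sim-universe      = cartesianProductWith _∼_ S S
  nsim-universe     = cartesianProductWith _≁_ S S
  universe          = labelled-universe ++ sim-universe ++ nsim-universe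

  in-universe : ∀ {e} → Over e → e ∈ universe
  in-universe {lab ℳ _} a∈S =
    ∈-++⁺ˡ (∈-cartesianProductWith⁺ lab (∈-labels ℳ) a∈S)
  in-universe {_ ∼ _} (a∈S , b∈S) =
    ∈-++⁺ʳ labelled-universe (∈-++⁺ˡ (∈-cartesianProductWith⁺ _∼_ a∈S b∈S))
  in-universe {_ ≁ _} (a∈S , b∈S) =
    ∈-++⁺ʳ labelled-universe (∈-++⁺ʳ sim-universe (∈-cartesianProductWith⁺ _≁_ a∈S b∈S))

  _⊏_ : Branch → Branch → Set
  B′ ⊏ B = missing universe B′ < missing universe B

  ⊏-wellFounded : WellFounded _⊏_
  ⊏-wellFounded = On.wellFounded (missing universe) <-wellFounded

  extension-⊏ : ∀ {B c} → All Over c → ¬ All (_∈ B) c → (c ++ B) ⊏ B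
  extension-⊏ {B} {c} over-c c⊈B with find (¬All⇒Any¬ (_∈? B) c c⊈B)
  ... | x , x∈c , x∉B =
    missing-strict universe (∈-++⁺ʳ c) (in-universe (lookup over-c x∈c)) (∈-++⁺ˡ x∈c) x∉B

  search : ∀ B → All Over B → Acc _⊏_ B → ClosedTableau B ⊎ HintikkaExtension B
  search B over (acc smaller) with closed? B | saturated-or-expandable B
  ... | yes closed-B | _        = inj₁ (closed closed-B)
  ... | no ¬closed-B | inj₁ sat = inj₂ (B , id , record { saturated = sat ; ¬closed = ¬closed-B })
  ... | no _ | inj₂ ((ps , cs , r) , ps⊆B , new) =
    Sum.map₁ (apply r (lookup ps⊆B) ∘ lookup)
      (All.sequenceA 0ℓ {P = λ c → ClosedTableau (c ++ B)} (SumRight.applicative 0ℓ _)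
        (All.tabulate expand))
    where
    expand : ∀ {c} → c ∈ cs → ClosedTableau (c ++ B) ⊎ HintikkaExtension B
    expand {c} c∈cs = Sum.map₂ (λ (B′ , c++B⊆B′ , H) → B′ , c++B⊆B′ ∘ ∈-++⁺ʳ c , H)
      (search (c ++ B) (++⁺ over-c over) (smaller (extension-⊏ over-c c⊈B)))
      where
      over-c : All Over c
      over-c = lookup (rules-preserve-over r (anti-mono (lookup ps⊆B) over)) c∈cs
      c⊈B : ¬ All (_∈ B) c
      c⊈B = lookup (¬Any⇒All¬ cs new) c∈cs

tableau-complete : ∀ {ℳ ℳ′} a b → (∀ v → v ⊩ lab ℳ a → ¬ v ⊩ lab ℳ′ b)
                 → ClosedTableau (lab ℳ a ∷ lab ℳ′ b ∷ [])
tableau-complete {ℳ} {ℳ′} a b unsatisfiable =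
  [ id , refute ]′ (search (lab ℳ a ∷ lab ℳ′ b ∷ []) (a∈S ∷ b∈S ∷ []) (⊏-wellFounded _))
  where
  S : List Form
  S = subformulas a ++ subformulas b
  open Search S (++-subformula-closed (subformulas-closed a) (subformulas-closed b))
  a∈S : a ∈ S
  a∈S = ∈-++⁺ˡ {xs = subformulas a} (here refl)
  b∈S : b ∈ S
  b∈S = ∈-++⁺ʳ (subformulas a) (here refl)
  refute : HintikkaExtension (lab ℳ a ∷ lab ℳ′ b ∷ []) → ClosedTableau (lab ℳ a ∷ lab ℳ′ b ∷ [])
  refute (B′ , B⊆B′ , H) =
    ⊥-elim (unsatisfiable v (forces (B⊆B′ (here refl))) (forces (B⊆B′ (there (here refl)))))
    where open HintikkaModel H

completeness : ∀ φ χ → φ ⊨ χ → φ ⊢ χ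
completeness φ χ φ⊨χ =
  tableau-complete φ χ (countermodel {𝔪} (λ ())) , tableau-complete φ χ (countermodel {𝔱} (λ ()))
  where
  countermodel : ∀ {ℳ} → ℳ ≢ 𝔣 → ∀ v → v ⊩ lab ℳ φ → ¬ v ⊩ f[ χ ]
  countermodel ℳ≢𝔣 v φ-holds = φ⊨χ v (ℳ≢𝔣 ∘ Holds-unique φ-holds)

theorem8 : ∀ (φ χ : Form) → ((φ ⊨ χ) → (φ ⊢ χ)) × ((φ ⊢ χ) → (φ ⊨ χ))
theorem8 φ χ = completeness φ χ , soundness φ χ
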